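{- Let $n\ge1$ and let $\tau\in\mathcal{R}_n^B$ have exactly $k$ modular runs. Then \[ \sum_{\sigma\in\mathrm{Orb}(\tau)}x^{\mathrm{des}(\sigma)}=(2x)^{k-1}(1+x)^{n-2k+1}. \]
   Context: $[n]=\{1,\dots,n\}$, $\langle n\rangle=\{0,\pm1,\dots,\pm n\}$. A type $B$ set partition of $\langle n\rangle$ without zero block is encoded as $\pi=\pi_1\mid\cdots\mid\pi_k$: nonempty sets of nonzero integers with the sets $\{|a|:a\in\pi_i\}$ partitioning $[n]$, the element of smallest absolute value $m_i$ of $\pi_i$ positive, $m_1<\cdots<m_k$. It is merging-free if there is no $i\ge2$ with $\max_{a\in\pi_{i-1}}|a|<m_i$. $\mathrm{Flatten}(\pi)$ concatenates $\pi_1,\pi_2,\dots$, each written in increasing order of absolute value; $\mathcal{R}_n^B$ is the set of $\mathrm{Flatten}(\pi)$ over merging-free $\pi$. For $\sigma=\sigma_1\cdots\sigma_n$, a modular run (mrun) is a maximal consecutive segment $\sigma_i\cdots\sigma_{i+j}$ with $|\sigma_i|<\cdots<|\sigma_{i+j}|$; $\sigma_i$ is its bottom. For $i\in[n]$, $\psi_i(\sigma)$ is $\sigma$ with $\sigma_i$ replaced by $-\sigma_i$ if $\sigma_i$ is not the bottom of an mrun, and $\psi_i(\sigma)=\sigma$ otherwise; $\psi_S=\prod_{i\in S}\psi_i$, and $\mathrm{Orb}(\tau)=\{\psi_S(\tau):S\subseteq[n]\}$. $i\in[n-1]$ is a descent of $\sigma$ if $\sigma_i>\sigma_{i+1}$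 (usual integer order); $\mathrm{des}(\sigma)$ is the number of descents. -}

module Defs where

open import Data.Bool using (Bool; true; false; if_then_else_)
open import Data.Nat as ℕ using (ℕ; zero; suc; _⊔_)
open import Data.Integer as ℤ using (ℤ; +_; ∣_∣; -_; 0ℤ)
import Data.Integer.Properties as ℤP
open import Data.List using (List; []; _∷_; map; concat; concatMap; foldr; upTo; length; deduplicate; sum)
open import Data.List.Properties using (≡-dec)
open import Data.List.Relation.Unary.All using (All)
open import Data.List.Relation.Unary.Linked using (Linked)
open import Data.List.Relation.Binary.Permutation.Propositional using (_↭_)
open import Data.Product using (∃; _×_)
open import Data.Unit using (⊤)
open import Relation.Nullary using (¬_; does)
open import Relation.Binary.PropositionalEquality using (_≡_; _≢_)

range : ℕ → List ℕ
range n = map suc (upTo n)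

-- A block is a finite set of nonzero integers; since absolute values
-- within (and across) blocks are distinct, it is represented uniquely
-- by the list of its elements in increasing order of absolute value.

AbsIncreasing : List ℤ → Set
AbsIncreasing = Linked (λ a b → ∣ a ∣ ℕ.< ∣ b ∣)

minAbs : List ℤ → ℕ
minAbs []      = 0
minAbs (a ∷ _) = ∣ a ∣

MinPositive : List ℤ → Set
MinPositive []      = ⊤
MinPositive (a ∷ _) = 0ℤ ℤ.< a

maxAbs : List ℤ → ℕ
maxAbs B = foldr _⊔_ 0 (map ∣_∣ B)

IsTypeBPartition : ℕ → List (List ℤ) → Set
IsTypeBPartition n π =
  All (λ B → B ≢ []) π ×
  All (All (λ a → a ≢ 0ℤ)) π ×
  All AbsIncreasing π ×
  (map ∣_∣ (concat π) ↭ range n) ×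
  All MinPositive π ×
  Linked (λ B C → minAbs B ℕ.< minAbs C) π

MergingFree : List (List ℤ) → Set
MergingFree = Linked (λ B C → ¬ (maxAbs B ℕ.< minAbs C))

Flatten : List (List ℤ) → List ℤ
Flatten = concat

InRB : ℕ → List ℤ → Set
InRB n τ = ∃ λ π → IsTypeBPartition n π × MergingFree π × Flatten π ≡ τ

consRun : ℤ → List (List ℤ) → List (List ℤ)
consRun a []              = (a ∷ []) ∷ []
consRun a ([] ∷ rs)       = (a ∷ []) ∷ rs
consRun a ((b ∷ r) ∷ rs) =
  if does (∣ a ∣ ℕ.<? ∣ b ∣) then (a ∷ b ∷ r) ∷ rs else (a ∷ []) ∷ (b ∷ r) ∷ rs

mruns : List ℤ → List (List ℤ)
mruns []       = []
mruns (a ∷ xs) = consRun a (mruns xs)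

bottomFlags : List ℤ → List Bool
bottomFlags σ = concatMap flags (mruns σ)
  where
  flags : List ℤ → List Bool
  flags []      = []
  flags (_ ∷ r) = true ∷ map (λ _ → false) r

-- i-th entry (1-indexed) of a Bool list (false out of range)
nth : List Bool → ℕ → Bool
nth []       _             = false
nth (b ∷ _)  (suc zero)    = b
nth (_ ∷ bs) (suc (suc i)) = nth bs (suc i)
nth (_ ∷ _)  zero          = false

isBottom : List ℤ → ℕ → Bool
isBottom σ i = nth (bottomFlags σ) i

negAt : ℕ → List ℤ → List ℤ
negAt _             []       = []
negAt zero          (a ∷ xs) = a ∷ xs
negAt (suc zero)    (a ∷ xs) = (- a) ∷ xs
negAt (suc (suc i)) (a ∷ xs) = a ∷ negAt (suc i) xs

ψ : ℕ → List ℤ → List ℤ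
ψ i σ = if isBottom σ i then σ else negAt i σ

ψS : List ℕ → List ℤ → List ℤ
ψS S σ = foldr ψ σ S

subsets : List ℕ → List (List ℕ)
subsets []       = [] ∷ []
subsets (x ∷ xs) = subsets xs Data.List.++ map (x ∷_) (subsets xs)

Orb : ℕ → List ℤ → List (List ℤ)
Orb n τ = deduplicate (≡-dec ℤ._≟_) (map (λ S → ψS S τ) (subsets (range n)))

-- descents (usual integer order)

des : List ℤ → ℕ
des []           = 0
des (_ ∷ [])     = 0
des (a ∷ b ∷ xs) = (if does (b ℤ.<? a) then 1 else 0) ℕ.+ des (b ∷ xs)

sumℤ : List ℤ → ℤ
sumℤ = foldr ℤ._+_ 0ℤ

-- The map ψ never changes absolute values, so it never changes which entries
-- are mrun bottoms; hence the orbit of τ consists of all sign choices of the n − k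
-- non-bottom ("free") entries, each obtained exactly once. Within an mrun absolute values
-- increase, so whether the step into a free entry is a descent depends only on the sign of
-- that entry, and summing over its two signs gives a factor 1 + x. The exception is the
-- last entry b of a non-final mrun of τ ∈ R_n^B: merging-freeness makes |b| exceed the next
-- bottom as well, so for either sign of b exactly one of the two steps around b is a
-- descent, giving 2x. There are k − 1 such entries, whence (2x)^(k−1) (1+x)^(n−2k+1).
module Submission where

open import Defs
open import Data.Nat using (ℕ; _≤_; _∸_; _+_)
open import Data.Integer using (ℤ; +_; _^_; 1ℤ) renaming (_*_ to _*ℤ_; _+_ to _+ℤ_)
open import Algebra.Bundles using (CommutativeMonoid)
import Algebra.Properties.CommutativeSemigroup as CommutativeSemigroupProperties
open import Data.Bool using (Bool; true; false; if_then_else_)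
open import Data.Empty using (⊥-elim)
open import Data.Integer as ℤ using (-[1+_]; ∣_∣; -_; 0ℤ)
import Data.Integer.Properties as ℤₚ
open import Data.List using (List; []; _∷_; _++_; map; length; concat; concatMap; foldr; upTo)
open import Data.List.Properties
  using (map-++; map-∘; map-cong; concatMap-cong; map-upTo; length-map; length-++; length-upTo;
         ++-identityʳ; ∷-injectiveˡ; ∷-injectiveʳ; ≡-dec)
open import Data.List.Membership.Propositional using (_∈_)
open import Data.List.Membership.Propositional.Properties using (∈-map⁺; ∈-map⁻; ∈-++⁺ʳ; deduplicate-∈⇔)
open import Data.List.Membership.Propositional.Properties.WithK using (unique∧set⇒bag)
open import Data.List.Relation.Binary.BagAndSetEquality
  using (_∼[_]_; set; ∼bag⇒↭; ++-cong; ++-idempotent) renaming (map-cong to ∼-map-cong)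
open import Data.List.Relation.Binary.Disjoint.Propositional using (Disjoint)
open import Data.List.Relation.Binary.Permutation.Propositional using (_↭_; ↭-sym; ↭⇒↭ₛ)
import Data.List.Relation.Binary.Permutation.Propositional.Properties as ↭
open import Data.List.Relation.Binary.Permutation.Setoid.Properties using (foldr-commMonoid; Unique-resp-↭)
open import Data.List.Relation.Binary.Pointwise as Pointwise using (Pointwise; []; _∷_)
open import Data.List.Relation.Unary.All as All using (All; []; _∷_)
import Data.List.Relation.Unary.All.Properties as Allₚ
open import Data.List.Relation.Unary.Any using (here; there)
open import Data.List.Relation.Unary.AllPairs using ([]; _∷_)
open import Data.List.Relation.Unary.Linked using (Linked; [-]; _∷_)
open import Data.List.Relation.Unary.Unique.Propositional using (Unique)
import Data.List.Relation.Unary.Unique.Propositional.Properties as Unique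
open import Data.List.Relation.Unary.Unique.DecPropositional.Properties (≡-dec ℤ._≟_) using (deduplicate-!)
import Data.Nat as ℕ
import Data.Nat.Properties as ℕₚ
open import Data.Nat.Solver using (module +-*-Solver)
open import Data.Product using (_,_)
open import Function using (_∘_; _on_)
open import Function.Properties.Equivalence using () renaming (sym to ⇔-sym)
open import Function.Related.Propositional using (K-refl; K-trans)
open import Relation.Binary.PropositionalEquality
  using (_≡_; _≢_; refl; setoid; sym; trans; cong; cong₂; subst; module ≡-Reasoning)
open import Relation.Nullary using (¬_; does)
open import Relation.Nullary.Decidable using (dec-true; dec-false)

private
  variable
    A : Set
    a b m p : ℤ
    r xs ys : List ℤ
    π : List (List ℤ)

sumℤ-++ : ∀ xs ys → sumℤ (xs ++ ys) ≡ sumℤ xs +ℤ sumℤ ys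
sumℤ-++ []       ys = sym (ℤₚ.+-identityˡ (sumℤ ys))
sumℤ-++ (a ∷ xs) ys = trans (cong (a +ℤ_) (sumℤ-++ xs ys)) (sym (ℤₚ.+-assoc a (sumℤ xs) (sumℤ ys)))

sumℤ-↭ : xs ↭ ys → sumℤ xs ≡ sumℤ ys
sumℤ-↭ xs↭ys = foldr-commMonoid +-0.setoid +-0.isCommutativeMonoid (↭⇒↭ₛ xs↭ys)
  where module +-0 = CommutativeMonoid ℤₚ.+-0-commutativeMonoid

i≡-i⇒i≡0 : a ≡ - a → a ≡ 0ℤ
i≡-i⇒i≡0 {+ 0} _ = refl

∣i∣<n⇒i<n : ∀ a {n} → ∣ a ∣ ℕ.< n → a ℤ.< + n
∣i∣<n⇒i<n (+ _)    i<n = ℤ.+<+ i<n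
∣i∣<n⇒i<n -[1+ _ ] _   = ℤ.-<+

∣i∣<1+n⇒-[1+n]<i : ∀ a {n} → ∣ a ∣ ℕ.< ℕ.suc n → -[1+ n ] ℤ.< a
∣i∣<1+n⇒-[1+n]<i (+ _)    _            = ℤ.-<+
∣i∣<1+n⇒-[1+n]<i -[1+ _ ] (ℕ.s≤s i<n) = ℤ.-<- i<n

descentBit : ℤ → ℤ → ℕ
descentBit a b = if does (b ℤ.<? a) then 1 else 0

descentBit-down : b ℤ.< a → descentBit a b ≡ 1
descentBit-down {b} {a} b<a rewrite dec-true (b ℤ.<? a) b<a = refl

descentBit-up : a ℤ.< b → descentBit a b ≡ 0
descentBit-up {a} {b} a<b rewrite dec-false (b ℤ.<? a) (ℤₚ.<-asym a<b) = refl

-- b is a peak if positive and a valley if negative.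
descentBit-through : ∣ a ∣ ℕ.< ∣ b ∣ → ∣ m ∣ ℕ.< ∣ b ∣ → descentBit a b + descentBit b m ≡ 1
descentBit-through {a} {+ ℕ.suc _} {m} a<b m<b
  rewrite descentBit-up (∣i∣<n⇒i<n a a<b) | descentBit-down (∣i∣<n⇒i<n m m<b) = refl
descentBit-through {a} { -[1+ _ ]} {m} a<b m<b
  rewrite descentBit-down (∣i∣<1+n⇒-[1+n]<i a a<b) | descentBit-up (∣i∣<1+n⇒-[1+n]<i m m<b) = refl

lastOf : ℤ → List ℤ → ℤ
lastOf b []      = b
lastOf _ (c ∷ r) = lastOf c r

lastOf-∈ : ∀ b r → lastOf b r ∈ b ∷ r
lastOf-∈ b []      = here refl
lastOf-∈ b (c ∷ r) = there (lastOf-∈ c r)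

AbsIncreasing-neg : AbsIncreasing (b ∷ r) → AbsIncreasing (- b ∷ r)
AbsIncreasing-neg     [-]          = [-]
AbsIncreasing-neg {b} (b<c ∷ incr) = subst (ℕ._< _) (sym (ℤₚ.∣-i∣≡∣i∣ b)) b<c ∷ incr

maxAbs-≤-lastOf : AbsIncreasing (b ∷ r) → maxAbs (b ∷ r) ℕ.≤ ∣ lastOf b r ∣
maxAbs-≤-lastOf {r = []}    _            = ℕₚ.⊔-lub ℕₚ.≤-refl ℕ.z≤n
maxAbs-≤-lastOf {r = c ∷ r} (b<c ∷ incr) =
  ℕₚ.⊔-lub (ℕₚ.≤-trans (ℕₚ.<⇒≤ b<c) (ℕₚ.≤-trans (ℕₚ.m≤m⊔n ∣ c ∣ (maxAbs r)) c≤last)) c≤last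
  where c≤last = maxAbs-≤-lastOf incr

Unique-++⁻ʳ : ∀ (xs : List A) {ys} → Unique (xs ++ ys) → Unique ys
Unique-++⁻ʳ []       u       = u
Unique-++⁻ʳ (_ ∷ xs) (_ ∷ u) = Unique-++⁻ʳ xs u

Unique-++-disjoint : ∀ (xs : List A) {ys a b} → Unique (xs ++ ys) → a ∈ xs → b ∈ ys → a ≢ b
Unique-++-disjoint (_ ∷ xs) (x∉ ∷ _) (here refl) b∈ = All.lookup x∉ (∈-++⁺ʳ xs b∈)
Unique-++-disjoint (_ ∷ xs) (_ ∷ u)  (there a∈) b∈ = Unique-++-disjoint xs u a∈ b∈

-- Modular runs

consRun-extend : ∀ {a b r rs} → ∣ a ∣ ℕ.< ∣ b ∣ → consRun a ((b ∷ r) ∷ rs) ≡ (a ∷ b ∷ r) ∷ rs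
consRun-extend {a} {b} a<b rewrite dec-true (∣ a ∣ ℕ.<? ∣ b ∣) a<b = refl

consRun-break : ∀ {a b r rs} → ¬ ∣ a ∣ ℕ.< ∣ b ∣ → consRun a ((b ∷ r) ∷ rs) ≡ (a ∷ []) ∷ (b ∷ r) ∷ rs
consRun-break {a} {b} a≮b rewrite dec-false (∣ a ∣ ℕ.<? ∣ b ∣) a≮b = refl

concat-consRun : ∀ a L → concat (consRun a L) ≡ a ∷ concat L
concat-consRun a []            = refl
concat-consRun a ([] ∷ L)      = refl
concat-consRun a ((b ∷ r) ∷ L) with does (∣ a ∣ ℕ.<? ∣ b ∣)
... | true  = refl
... | false = refl

concat-mruns : ∀ σ → concat (mruns σ) ≡ σ
concat-mruns []      = refl
concat-mruns (a ∷ σ) = trans (concat-consRun a (mruns σ)) (cong (a ∷_) (concat-mruns σ))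

mruns-run : ∀ {b B} ys → AbsIncreasing (b ∷ B) →
  consRun (lastOf b B) (mruns ys) ≡ (lastOf b B ∷ []) ∷ mruns ys → mruns (b ∷ B ++ ys) ≡ (b ∷ B) ∷ mruns ys
mruns-run {B = []}    ys _            breaks = breaks
mruns-run {B = _ ∷ _} ys (b<c ∷ incr) breaks =
  trans (cong (consRun _) (mruns-run ys incr breaks)) (consRun-extend b<c)

blockFlags : List ℤ → List Bool
blockFlags []      = []
blockFlags (_ ∷ r) = true ∷ map (λ _ → false) r

bottomFlags-blockFlags : ∀ σ → bottomFlags σ ≡ concatMap blockFlags (mruns σ)
bottomFlags-blockFlags σ = concatMap-cong (λ { [] → refl ; (_ ∷ _) → refl }) (mruns σ)

length-bottomFlags : ∀ σ → length (bottomFlags σ) ≡ length σ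
length-bottomFlags σ = begin
  length (bottomFlags σ)                    ≡⟨ cong length (bottomFlags-blockFlags σ) ⟩
  length (concatMap blockFlags (mruns σ))   ≡⟨ length-concatMap-blockFlags (mruns σ) ⟩
  length (concat (mruns σ))                 ≡⟨ cong length (concat-mruns σ) ⟩
  length σ                                  ∎
  where
  open ≡-Reasoning
  length-blockFlags : ∀ B → length (blockFlags B) ≡ length B
  length-blockFlags []      = refl
  length-blockFlags (_ ∷ r) = cong ℕ.suc (length-map _ r)
  length-concatMap-blockFlags : ∀ L → length (concatMap blockFlags L) ≡ length (concat L)
  length-concatMap-blockFlags []      = refl
  length-concatMap-blockFlags (B ∷ L) = begin
    length (blockFlags B ++ concatMap blockFlags L)           ≡⟨ length-++ (blockFlags B) ⟩
    length (blockFlags B) + length (concatMap blockFlags L)   ≡⟨ cong₂ _+_ (length-blockFlags B) (length-concatMap-blockFlags L) ⟩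
    length B + length (concat L)                              ≡⟨ length-++ B ⟨
    length (B ++ concat L)                                    ∎

-- The blocks of a merging-free partition as they sit in its flattening: each non-final
-- block has at least two entries and ends above, in absolute value, the first entry of the
-- next block, so that the blocks are exactly the mruns.
data MrunChain : List (List ℤ) → Set where
  final : ∀ {m r} → AbsIncreasing (m ∷ r) → MrunChain ((m ∷ r) ∷ [])
  link  : ∀ {m b r m′ r′ π} → AbsIncreasing (m ∷ b ∷ r) → ∣ m′ ∣ ℕ.< ∣ lastOf b r ∣ →
          MrunChain ((m′ ∷ r′) ∷ π) → MrunChain ((m ∷ b ∷ r) ∷ (m′ ∷ r′) ∷ π)

mruns-concat : MrunChain π → mruns (concat π) ≡ π
mruns-concat (final incr) = mruns-run [] incr refl
mruns-concat (link {_} {b} {r} {m′} {r′} {π} incr m′<last chain) =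
  trans (mruns-run rest incr breaks) (cong (_ ∷_) (mruns-concat chain))
  where
  rest = concat ((m′ ∷ r′) ∷ π)
  breaks : consRun (lastOf b r) (mruns rest) ≡ (lastOf b r ∷ []) ∷ mruns rest
  breaks rewrite mruns-concat chain = consRun-break (ℕₚ.<-asym m′<last)

-- The entries contributing a factor 1 + x: those neither first in a block nor last in a
-- non-final block.
interiorCount : List (List ℤ) → ℕ
interiorCount []          = 0
interiorCount (B ∷ [])    = length B ∸ 1
interiorCount (B ∷ C ∷ π) = length B ∸ 2 + interiorCount (C ∷ π)

interiorCount-chain : MrunChain π → interiorCount π + (length π + length π) ≡ length (concat π) + 1
interiorCount-chain (final {r = r} _) rewrite ++-identityʳ r = ℕₚ.+-suc (length r) 1
interiorCount-chain (link {m} {b} {r} {m′} {r′} {π} _ _ chain) = begin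
  (length r + I) + (ℕ.suc K + ℕ.suc K)  ≡⟨ rearrange (length r) I K ⟩
  2 + (length r + (I + (K + K)))        ≡⟨ cong (λ n → 2 + (length r + n)) (interiorCount-chain chain) ⟩
  2 + (length r + (N + 1))              ≡⟨ cong (λ n → 2 + n) (ℕₚ.+-assoc (length r) N 1) ⟨
  2 + (length r + N) + 1                ≡⟨ cong (λ n → 2 + n + 1) (length-++ r) ⟨
  length (concat ((m ∷ b ∷ r) ∷ (m′ ∷ r′) ∷ π)) + 1 ∎
  where
  open ≡-Reasoning
  open +-*-Solver using (solve; _:+_; _:=_; con)
  I = interiorCount ((m′ ∷ r′) ∷ π)
  K = length ((m′ ∷ r′) ∷ π)
  N = length (concat ((m′ ∷ r′) ∷ π))
  rearrange : ∀ l i k → (l + i) + (ℕ.suc k + ℕ.suc k) ≡ 2 + (l + (i + (k + k)))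
  rearrange = solve 3 (λ l i k → (l :+ i) :+ ((con 1 :+ k) :+ (con 1 :+ k)) := con 2 :+ (l :+ (i :+ (k :+ k)))) refl

-- Distinctness of absolute values turns the weak inequality of merging-freeness into a strict one.
mergingFree⇒mrunChain : π ≢ [] → All (_≢ []) π → All AbsIncreasing π →
  Linked (λ B C → minAbs B ℕ.< minAbs C) π → MergingFree π → Unique (map ∣_∣ (concat π)) → MrunChain π
mergingFree⇒mrunChain {[]}                           π≢[] _ _ _ _ _ = ⊥-elim (π≢[] refl)
mergingFree⇒mrunChain {[] ∷ _}                       _ (B≢[] ∷ _) _ _ _ _ = ⊥-elim (B≢[] refl)
mergingFree⇒mrunChain {(_ ∷ _) ∷ []}                 _ _ (incr ∷ _) _ _ _ = final incr
mergingFree⇒mrunChain {(_ ∷ _) ∷ [] ∷ _}             _ (_ ∷ C≢[] ∷ _) _ _ _ _ = ⊥-elim (C≢[] refl)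
mergingFree⇒mrunChain {(m ∷ []) ∷ (m′ ∷ _) ∷ _}      _ _ _ (m<m′ ∷ _) (≮ ∷ _) _ =
  ⊥-elim (≮ (subst (ℕ._< ∣ m′ ∣) (sym (ℕₚ.⊔-identityʳ ∣ m ∣)) m<m′))
mergingFree⇒mrunChain {(m ∷ b ∷ r) ∷ (m′ ∷ r′) ∷ π} _ (_ ∷ ne) (incr ∷ incrs) (_ ∷ ordered) (≮ ∷ mf) (_ ∷ u) =
  link incr m′<last (mergingFree⇒mrunChain (λ ()) ne incrs ordered mf (Unique-++⁻ʳ (map ∣_∣ (b ∷ r)) u′))
  where
  u′ : Unique (map ∣_∣ (b ∷ r) ++ map ∣_∣ (concat ((m′ ∷ r′) ∷ π)))
  u′ = subst Unique (map-++ ∣_∣ (b ∷ r) _) u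
  m′<last : ∣ m′ ∣ ℕ.< ∣ lastOf b r ∣
  m′<last = ℕₚ.≤∧≢⇒< (ℕₚ.≤-trans (ℕₚ.≮⇒≥ ≮) (maxAbs-≤-lastOf incr))
    (λ eq → Unique-++-disjoint (map ∣_∣ (b ∷ r)) u′ (∈-map⁺ ∣_∣ (lastOf-∈ b r)) (here refl) (sym eq))

typeBPartition-length : ∀ {n} → IsTypeBPartition n π → length (concat π) ≡ n
typeBPartition-length {π} {n} (_ , _ , _ , perm , _) = begin
  length (concat π)             ≡⟨ length-map ∣_∣ (concat π) ⟨
  length (map ∣_∣ (concat π))   ≡⟨ ↭.↭-length perm ⟩
  length (map ℕ.suc (upTo n))   ≡⟨ length-map ℕ.suc (upTo n) ⟩
  length (upTo n)               ≡⟨ length-upTo n ⟩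
  n                             ∎
  where open ≡-Reasoning

typeBPartition⇒mrunChain : ∀ {n} → 1 ≤ n → IsTypeBPartition n π → MergingFree π → MrunChain π
typeBPartition⇒mrunChain {π} {n} 1≤n partition@(ne , _ , incr , perm , _ , ordered) mf =
  mergingFree⇒mrunChain π≢[] ne incr ordered mf
    (Unique-resp-↭ (setoid ℕ) (↭⇒↭ₛ (↭-sym perm)) (Unique.map⁺ ℕₚ.suc-injective (Unique.upTo⁺ n)))
  where
  π≢[] : π ≢ []
  π≢[] refl = ℕₚ.<⇒≢ 1≤n (typeBPartition-length partition)

-- Orbits

SameAbs : List ℤ → List ℤ → Set
SameAbs = Pointwise (_≡_ on ∣_∣)

consRun-sameAbs : ∀ {a a′ L L′} → ∣ a ∣ ≡ ∣ a′ ∣ → Pointwise SameAbs L L′ →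
  Pointwise SameAbs (consRun a L) (consRun a′ L′)
consRun-sameAbs a≈a′ []        = (a≈a′ ∷ []) ∷ []
consRun-sameAbs a≈a′ ([] ∷ L≈) = (a≈a′ ∷ []) ∷ L≈
consRun-sameAbs {a} {a′} a≈a′ (_∷_ {b ∷ _} {b′ ∷ _} (b≈b′ ∷ r≈) L≈)
  rewrite a≈a′ | b≈b′ with does (∣ a′ ∣ ℕ.<? ∣ b′ ∣)
... | true  = (a≈a′ ∷ b≈b′ ∷ r≈) ∷ L≈
... | false = (a≈a′ ∷ []) ∷ (b≈b′ ∷ r≈) ∷ L≈

mruns-sameAbs : ∀ {σ σ′} → SameAbs σ σ′ → Pointwise SameAbs (mruns σ) (mruns σ′)
mruns-sameAbs []        = []
mruns-sameAbs (a≈ ∷ σ≈) = consRun-sameAbs a≈ (mruns-sameAbs σ≈)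

bottomFlags-sameAbs : ∀ {σ σ′} → SameAbs σ σ′ → bottomFlags σ ≡ bottomFlags σ′
bottomFlags-sameAbs {σ} {σ′} σ≈ = begin
  bottomFlags σ                    ≡⟨ bottomFlags-blockFlags σ ⟩
  concatMap blockFlags (mruns σ)   ≡⟨ concatMap-blockFlags-cong (mruns-sameAbs σ≈) ⟩
  concatMap blockFlags (mruns σ′)  ≡⟨ bottomFlags-blockFlags σ′ ⟨
  bottomFlags σ′                   ∎
  where
  open ≡-Reasoning
  falses-cong : ∀ {r r′} → SameAbs r r′ → map (λ _ → false) r ≡ map (λ _ → false) r′
  falses-cong []       = refl
  falses-cong (_ ∷ r≈) = cong (false ∷_) (falses-cong r≈)
  blockFlags-cong : ∀ {B B′} → SameAbs B B′ → blockFlags B ≡ blockFlags B′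
  blockFlags-cong []       = refl
  blockFlags-cong (_ ∷ r≈) = cong (true ∷_) (falses-cong r≈)
  concatMap-blockFlags-cong : ∀ {L L′} → Pointwise SameAbs L L′ → concatMap blockFlags L ≡ concatMap blockFlags L′
  concatMap-blockFlags-cong []        = refl
  concatMap-blockFlags-cong (B≈ ∷ L≈) = cong₂ _++_ (blockFlags-cong B≈) (concatMap-blockFlags-cong L≈)

ψWith : List Bool → ℕ → List ℤ → List ℤ
ψWith F i σ = if nth F i then σ else negAt i σ

negAt-sameAbs : ∀ i σ → SameAbs (negAt i σ) σ
negAt-sameAbs _                 []      = []
negAt-sameAbs 0                 (a ∷ σ) = Pointwise.refl refl
negAt-sameAbs 1                 (a ∷ σ) = ℤₚ.∣-i∣≡∣i∣ a ∷ Pointwise.refl refl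
negAt-sameAbs (ℕ.suc (ℕ.suc i)) (a ∷ σ) = refl ∷ negAt-sameAbs (ℕ.suc i) σ

foldr-ψWith-sameAbs : ∀ F τ S → SameAbs (foldr (ψWith F) τ S) τ
foldr-ψWith-sameAbs F τ []      = Pointwise.refl refl
foldr-ψWith-sameAbs F τ (i ∷ S) = Pointwise.transitive trans (ψWith-sameAbs i _) (foldr-ψWith-sameAbs F τ S)
  where
  ψWith-sameAbs : ∀ i σ → SameAbs (ψWith F i σ) σ
  ψWith-sameAbs i σ with nth F i
  ... | true  = Pointwise.refl refl
  ... | false = negAt-sameAbs i σ

ψS-frozen : ∀ τ S → ψS S τ ≡ foldr (ψWith (bottomFlags τ)) τ S
ψS-frozen τ []      = refl
ψS-frozen τ (i ∷ S) rewrite ψS-frozen τ S =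
  cong (λ F → ψWith F i σ) (bottomFlags-sameAbs (foldr-ψWith-sameAbs (bottomFlags τ) τ S))
  where σ = foldr (ψWith (bottomFlags τ)) τ S

ψWith-shift : ∀ f F j a σ → ψWith (f ∷ F) (ℕ.suc (ℕ.suc j)) (a ∷ σ) ≡ a ∷ ψWith F (ℕ.suc j) σ
ψWith-shift f F j a σ with nth F (ℕ.suc j)
... | true  = refl
... | false = refl

ψWith-head : ∀ f F a σ → ψWith (f ∷ F) 1 (a ∷ σ) ≡ (if f then a else - a) ∷ σ
ψWith-head true  F a σ = refl
ψWith-head false F a σ = refl

subsets-map : ∀ (f : ℕ → ℕ) xs → subsets (map f xs) ≡ map (map f) (subsets xs)
subsets-map f []       = refl
subsets-map f (x ∷ xs) rewrite subsets-map f xs = begin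
  map (map f) S ++ map (f x ∷_) (map (map f) S)  ≡⟨ cong (map (map f) S ++_) (map-∘ S) ⟨
  map (map f) S ++ map (map f ∘ (x ∷_)) S        ≡⟨ cong (map (map f) S ++_) (map-∘ S) ⟩
  map (map f) S ++ map (map f) (map (x ∷_) S)    ≡⟨ map-++ (map f) S _ ⟨
  map (map f) (S ++ map (x ∷_) S)                ∎
  where
  open ≡-Reasoning
  S = subsets xs

-- A true flag fixes the sign of its entry, a false flag lets it take both signs; entries
-- past the end of the flags are fixed.
signings : List Bool → List ℤ → List (List ℤ)
signings []          xs       = xs ∷ []
signings (_ ∷ _)     []       = [] ∷ []
signings (true ∷ F)  (a ∷ xs) = map (a ∷_) (signings F xs)
signings (false ∷ F) (a ∷ xs) = map (a ∷_) (signings F xs) ++ map (- a ∷_) (signings F xs)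

-- All ψ_S(xs) with frozen bottom flags, S = map suc S′ for S′ ⊆ {0, …, length xs − 1}, so
-- that the list unfolds along xs.
orbitList : List Bool → List ℤ → List (List ℤ)
orbitList F xs = map (λ S → foldr (ψWith F) xs (map ℕ.suc S)) (subsets (upTo (length xs)))

orbitList-cons : ∀ f F a xs →
  orbitList (f ∷ F) (a ∷ xs) ≡ map (a ∷_) (orbitList F xs) ++ map ((if f then a else - a) ∷_) (orbitList F xs)
orbitList-cons f F a xs = begin
  map h (subsets (upTo (ℕ.suc (length xs))))
    ≡⟨ cong (map h ∘ subsets ∘ (0 ∷_)) (map-upTo ℕ.suc (length xs)) ⟨
  map h (subsets (map ℕ.suc U) ++ map (0 ∷_) (subsets (map ℕ.suc U)))
    ≡⟨ cong (λ T → map h (T ++ map (0 ∷_) T)) (subsets-map ℕ.suc U) ⟩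
  map h (map (map ℕ.suc) SU ++ map (0 ∷_) (map (map ℕ.suc) SU))
    ≡⟨ map-++ h (map (map ℕ.suc) SU) _ ⟩
  map h (map (map ℕ.suc) SU) ++ map h (map (0 ∷_) (map (map ℕ.suc) SU))
    ≡⟨ cong₂ _++_ (trans (sym (map-∘ SU)) (map-cong shift SU))
                  (trans (cong (map h) (sym (map-∘ SU))) (trans (sym (map-∘ SU)) (map-cong head SU))) ⟩
  map ((a ∷_) ∘ g) SU ++ map ((c ∷_) ∘ g) SU
    ≡⟨ cong₂ _++_ (map-∘ SU) (map-∘ SU) ⟩
  map (a ∷_) (map g SU) ++ map (c ∷_) (map g SU) ∎
  where
  open ≡-Reasoning
  U = upTo (length xs)
  SU = subsets U
  c = if f then a else - a
  g = λ S → foldr (ψWith F) xs (map ℕ.suc S)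
  h = λ S → foldr (ψWith (f ∷ F)) (a ∷ xs) (map ℕ.suc S)
  shift : ∀ S → h (map ℕ.suc S) ≡ a ∷ g S
  shift []      = refl
  shift (j ∷ S) = trans (cong (ψWith (f ∷ F) (ℕ.suc (ℕ.suc j))) (shift S)) (ψWith-shift f F j a (g S))
  head : ∀ S → h (0 ∷ map ℕ.suc S) ≡ c ∷ g S
  head S = trans (cong (ψWith (f ∷ F) 1) (shift S)) (ψWith-head f F a (g S))

orbitList∼signings : ∀ F xs → length F ≡ length xs → orbitList F xs ∼[ set ] signings F xs
orbitList∼signings []          []       _  = K-refl
orbitList∼signings (true ∷ F)  (a ∷ xs) eq rewrite orbitList-cons true F a xs =
  K-trans (++-idempotent (map (a ∷_) (orbitList F xs)))
          (∼-map-cong (λ _ → refl) (orbitList∼signings F xs (ℕₚ.suc-injective eq)))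
orbitList∼signings (false ∷ F) (a ∷ xs) eq rewrite orbitList-cons false F a xs =
  ++-cong (∼-map-cong (λ _ → refl) ih) (∼-map-cong (λ _ → refl) ih)
  where ih = orbitList∼signings F xs (ℕₚ.suc-injective eq)

signings-unique : ∀ F {xs} → All (_≢ 0ℤ) xs → Unique (signings F xs)
signings-unique []                   _          = [] ∷ []
signings-unique (_ ∷ _)     {[]}     _          = [] ∷ []
signings-unique (true ∷ F)  {a ∷ xs} (_ ∷ nz)   = Unique.map⁺ ∷-injectiveʳ (signings-unique F nz)
signings-unique (false ∷ F) {a ∷ xs} (a≢0 ∷ nz) =
  Unique.++⁺ (Unique.map⁺ ∷-injectiveʳ u) (Unique.map⁺ ∷-injectiveʳ u) disjoint
  where
  u = signings-unique F nz
  disjoint : Disjoint (map (a ∷_) (signings F xs)) (map (- a ∷_) (signings F xs))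
  disjoint (v∈₊ , v∈₋) with ∈-map⁻ (a ∷_) v∈₊ | ∈-map⁻ (- a ∷_) v∈₋
  ... | _ , _ , refl | _ , _ , eq = a≢0 (i≡-i⇒i≡0 (∷-injectiveˡ eq))

Orb↭signings : ∀ τ → All (_≢ 0ℤ) τ → Orb (length τ) τ ↭ signings (bottomFlags τ) τ
Orb↭signings τ nz = ∼bag⇒↭ (unique∧set⇒bag (deduplicate-! raw) (signings-unique bottoms nz) orbit∼)
  where
  open ≡-Reasoning
  bottoms = bottomFlags τ
  U = upTo (length τ)
  raw = map (λ S → ψS S τ) (subsets (range (length τ)))
  raw≡orbitList : raw ≡ orbitList bottoms τ
  raw≡orbitList = begin
    map (λ S → ψS S τ) (subsets (map ℕ.suc U))                  ≡⟨ map-cong (ψS-frozen τ) _ ⟩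
    map (foldr (ψWith bottoms) τ) (subsets (map ℕ.suc U))       ≡⟨ cong (map (foldr (ψWith bottoms) τ)) (subsets-map ℕ.suc U) ⟩
    map (foldr (ψWith bottoms) τ) (map (map ℕ.suc) (subsets U)) ≡⟨ map-∘ (subsets U) ⟨
    orbitList bottoms τ                                          ∎
  orbit∼ : Orb (length τ) τ ∼[ set ] signings bottoms τ
  orbit∼ = K-trans (⇔-sym (deduplicate-∈⇔ (≡-dec ℤ._≟_)))
    (subst (_∼[ set ] signings bottoms τ) (sym raw≡orbitList) (orbitList∼signings bottoms τ (length-bottomFlags τ)))

-- Descent generating function of the signings

module _ (x : ℤ) where

  weight : List ℤ → ℤ
  weight σ = x ^ des σ

  weightAfter : ℤ → List (List ℤ) → ℤ
  weightAfter p L = sumℤ (map (λ v → weight (p ∷ v)) L)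

  weightFrom : ℤ → List Bool → List ℤ → ℤ
  weightFrom p F xs = weightAfter p (signings F xs)

  weightAfter-cons : ∀ p a L → weightAfter p (map (a ∷_) L) ≡ x ^ descentBit p a *ℤ weightAfter a L
  weightAfter-cons p a []      = sym (ℤₚ.*-zeroʳ (x ^ descentBit p a))
  weightAfter-cons p a (v ∷ L) =
    trans (cong₂ _+ℤ_ (ℤₚ.^-distribˡ-+-* x (descentBit p a) (des (a ∷ v))) (weightAfter-cons p a L))
          (sym (ℤₚ.*-distribˡ-+ (x ^ descentBit p a) _ _))

  weightFrom-fixed : ∀ p a F xs → weightFrom p (true ∷ F) (a ∷ xs) ≡ x ^ descentBit p a *ℤ weightFrom a F xs
  weightFrom-fixed p a F xs = weightAfter-cons p a (signings F xs)

  weightFrom-free : ∀ p a F xs →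
    weightFrom p (false ∷ F) (a ∷ xs)
      ≡ x ^ descentBit p a *ℤ weightFrom a F xs +ℤ x ^ descentBit p (- a) *ℤ weightFrom (- a) F xs
  weightFrom-free p a F xs = begin
    sumℤ (map f (map (a ∷_) S ++ map (- a ∷_) S))          ≡⟨ cong sumℤ (map-++ f (map (a ∷_) S) _) ⟩
    sumℤ (map f (map (a ∷_) S) ++ map f (map (- a ∷_) S))  ≡⟨ sumℤ-++ (map f (map (a ∷_) S)) _ ⟩
    weightAfter p (map (a ∷_) S) +ℤ weightAfter p (map (- a ∷_) S)
      ≡⟨ cong₂ _+ℤ_ (weightAfter-cons p a S) (weightAfter-cons p (- a) S) ⟩
    x ^ descentBit p a *ℤ weightFrom a F xs +ℤ x ^ descentBit p (- a) *ℤ weightFrom (- a) F xs ∎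
    where
    open ≡-Reasoning
    S = signings F xs
    f = λ v → weight (p ∷ v)

  signPair-weight : ∣ p ∣ ℕ.< ∣ b ∣ → x ^ descentBit p b +ℤ x ^ descentBit p (- b) ≡ 1ℤ +ℤ x
  signPair-weight {p} {+ ℕ.suc _} p<b
    rewrite descentBit-up (∣i∣<n⇒i<n p p<b) | descentBit-down (∣i∣<1+n⇒-[1+n]<i p p<b) =
    cong (1ℤ +ℤ_) (ℤₚ.*-identityʳ x)
  signPair-weight {p} { -[1+ _ ]} p<b
    rewrite descentBit-down (∣i∣<1+n⇒-[1+n]<i p p<b) | descentBit-up (∣i∣<n⇒i<n p p<b) =
    trans (cong (_+ℤ 1ℤ) (ℤₚ.*-identityʳ x)) (ℤₚ.+-comm x 1ℤ)

  weightFrom-freeStep : ∀ {p b F xs U} → ∣ p ∣ ℕ.< ∣ b ∣ →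
    weightFrom b F xs ≡ U → weightFrom (- b) F xs ≡ U → weightFrom p (false ∷ F) (b ∷ xs) ≡ (1ℤ +ℤ x) *ℤ U
  weightFrom-freeStep {p} {b} {F} {xs} {U} p<b eq₊ eq₋ = begin
    weightFrom p (false ∷ F) (b ∷ xs)                       ≡⟨ weightFrom-free p b F xs ⟩
    x ^ descentBit p b *ℤ weightFrom b F xs +ℤ x ^ descentBit p (- b) *ℤ weightFrom (- b) F xs
      ≡⟨ cong₂ (λ u v → x ^ descentBit p b *ℤ u +ℤ x ^ descentBit p (- b) *ℤ v) eq₊ eq₋ ⟩
    x ^ descentBit p b *ℤ U +ℤ x ^ descentBit p (- b) *ℤ U  ≡⟨ ℤₚ.*-distribʳ-+ U (x ^ descentBit p b) (x ^ descentBit p (- b)) ⟨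
    (x ^ descentBit p b +ℤ x ^ descentBit p (- b)) *ℤ U     ≡⟨ cong (_*ℤ U) (signPair-weight {p} {b} p<b) ⟩
    (1ℤ +ℤ x) *ℤ U                                          ∎
    where open ≡-Reasoning

  weightFrom-boundary : ∀ {p b m F xs} → ∣ p ∣ ℕ.< ∣ b ∣ → ∣ m ∣ ℕ.< ∣ b ∣ →
    weightFrom p (false ∷ true ∷ F) (b ∷ m ∷ xs) ≡ + 2 *ℤ x *ℤ weightFrom m F xs
  weightFrom-boundary {p} {b} {m} {F} {xs} p<b m<b = begin
    weightFrom p (false ∷ true ∷ F) (b ∷ m ∷ xs)  ≡⟨ weightFrom-free p b (true ∷ F) (m ∷ xs) ⟩
    x ^ descentBit p b *ℤ weightFrom b (true ∷ F) (m ∷ xs)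
      +ℤ x ^ descentBit p (- b) *ℤ weightFrom (- b) (true ∷ F) (m ∷ xs)
      ≡⟨ cong₂ _+ℤ_ (through b p<b m<b) (through (- b) (subst (_ ℕ.<_) (sym ∣-b∣) p<b) (subst (_ ℕ.<_) (sym ∣-b∣) m<b)) ⟩
    x *ℤ W +ℤ x *ℤ W                              ≡⟨ ℤₚ.*-distribʳ-+ W x x ⟨
    (x +ℤ x) *ℤ W                                 ≡⟨ cong (_*ℤ W) x+x≡2x ⟩
    + 2 *ℤ x *ℤ W                                 ∎
    where
    open ≡-Reasoning
    W = weightFrom m F xs
    ∣-b∣ = ℤₚ.∣-i∣≡∣i∣ b
    x+x≡2x : x +ℤ x ≡ + 2 *ℤ x
    x+x≡2x = trans (cong₂ _+ℤ_ (sym (ℤₚ.*-identityˡ x)) (sym (ℤₚ.*-identityˡ x))) (sym (ℤₚ.*-distribʳ-+ x 1ℤ 1ℤ))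
    through : ∀ c → ∣ p ∣ ℕ.< ∣ c ∣ → ∣ m ∣ ℕ.< ∣ c ∣ → x ^ descentBit p c *ℤ weightFrom c (true ∷ F) (m ∷ xs) ≡ x *ℤ W
    through c p<c m<c = begin
      x ^ descentBit p c *ℤ weightFrom c (true ∷ F) (m ∷ xs)
        ≡⟨ cong (x ^ descentBit p c *ℤ_) (weightFrom-fixed c m F xs) ⟩
      x ^ descentBit p c *ℤ (x ^ descentBit c m *ℤ W)  ≡⟨ ℤₚ.*-assoc (x ^ descentBit p c) (x ^ descentBit c m) W ⟨
      x ^ descentBit p c *ℤ x ^ descentBit c m *ℤ W    ≡⟨ cong (_*ℤ W) (ℤₚ.^-distribˡ-+-* x (descentBit p c) (descentBit c m)) ⟨
      x ^ (descentBit p c + descentBit c m) *ℤ W       ≡⟨ cong (λ k → x ^ k *ℤ W) (descentBit-through {p} {c} {m} p<c m<c) ⟩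
      x ^ 1 *ℤ W                                       ≡⟨ cong (_*ℤ W) (ℤₚ.*-identityʳ x) ⟩
      x *ℤ W                                           ∎

  freeRun-weight : AbsIncreasing (p ∷ r) → weightFrom p (map (λ _ → false) r) r ≡ (1ℤ +ℤ x) ^ length r
  freeRun-weight {r = []}    _            = refl
  freeRun-weight {p} {b ∷ r} (p<b ∷ incr) =
    weightFrom-freeStep {p} {b} {map (λ _ → false) r} {r}
      p<b (freeRun-weight incr) (freeRun-weight (AbsIncreasing-neg incr))

  freeRun-boundary-weight : ∀ {b F m xs} → AbsIncreasing (p ∷ b ∷ r) → ∣ m ∣ ℕ.< ∣ lastOf b r ∣ →
    weightFrom p (false ∷ map (λ _ → false) r ++ true ∷ F) (b ∷ r ++ m ∷ xs)
      ≡ (1ℤ +ℤ x) ^ length r *ℤ (+ 2 *ℤ x *ℤ weightFrom m F xs)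
  freeRun-boundary-weight {p} {[]} {b} {F} {m} {xs} (p<b ∷ _) m<b =
    trans (weightFrom-boundary {p} {b} {m} {F} {xs} p<b m<b) (sym (ℤₚ.*-identityˡ _))
  freeRun-boundary-weight {p} {c ∷ r} {b} {F} {m} {xs} (p<b ∷ incr) m<last =
    trans (weightFrom-freeStep {p} {b} {false ∷ map (λ _ → false) r ++ true ∷ F} {c ∷ r ++ m ∷ xs}
             p<b (freeRun-boundary-weight incr m<last) (freeRun-boundary-weight (AbsIncreasing-neg incr) m<last))
          (sym (ℤₚ.*-assoc (1ℤ +ℤ x) _ _))

  weight-signings-fixedHead : ∀ m F xs → sumℤ (map weight (signings (true ∷ F) (m ∷ xs))) ≡ weightFrom m F xs
  weight-signings-fixedHead m F xs = cong sumℤ (sym (map-∘ (signings F xs)))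

  chainWeight-interior : MrunChain π →
    sumℤ (map weight (signings (concatMap blockFlags π) (concat π)))
      ≡ (+ 2 *ℤ x) ^ (length π ∸ 1) *ℤ (1ℤ +ℤ x) ^ interiorCount π
  chainWeight-interior (final {m} {r} incr)
    rewrite ++-identityʳ (map (λ _ → false) r) | ++-identityʳ r =
    trans (weight-signings-fixedHead m (map (λ _ → false) r) r)
          (trans (freeRun-weight incr) (sym (ℤₚ.*-identityˡ _)))
  chainWeight-interior (link {m} {b} {r} {m′} {r′} {π} incr m′<last chain) = begin
    sumℤ (map weight (signings (true ∷ false ∷ map (λ _ → false) r ++ true ∷ F′) (m ∷ b ∷ r ++ m′ ∷ xs′)))
      ≡⟨ weight-signings-fixedHead m (false ∷ map (λ _ → false) r ++ true ∷ F′) (b ∷ r ++ m′ ∷ xs′) ⟩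
    weightFrom m (false ∷ map (λ _ → false) r ++ true ∷ F′) (b ∷ r ++ m′ ∷ xs′)
      ≡⟨ freeRun-boundary-weight incr m′<last ⟩
    u ^ length r *ℤ (t *ℤ weightFrom m′ F′ xs′)
      ≡⟨ cong (λ w → u ^ length r *ℤ (t *ℤ w))
              (trans (sym (weight-signings-fixedHead m′ F′ xs′)) (chainWeight-interior chain)) ⟩
    u ^ length r *ℤ (t *ℤ (t ^ length π *ℤ u ^ I))
      ≡⟨ x∙yz≈y∙xz (u ^ length r) t _ ⟩
    t *ℤ (u ^ length r *ℤ (t ^ length π *ℤ u ^ I))
      ≡⟨ cong (t *ℤ_) (x∙yz≈y∙xz (u ^ length r) (t ^ length π) (u ^ I)) ⟩
    t *ℤ (t ^ length π *ℤ (u ^ length r *ℤ u ^ I))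
      ≡⟨ ℤₚ.*-assoc t (t ^ length π) _ ⟨
    t ^ ℕ.suc (length π) *ℤ (u ^ length r *ℤ u ^ I)
      ≡⟨ cong (t ^ ℕ.suc (length π) *ℤ_) (ℤₚ.^-distribˡ-+-* u (length r) I) ⟨
    t ^ ℕ.suc (length π) *ℤ u ^ (length r + I) ∎
    where
    open ≡-Reasoning
    open CommutativeSemigroupProperties ℤₚ.*-commutativeSemigroup using (x∙yz≈y∙xz)
    t = + 2 *ℤ x
    u = 1ℤ +ℤ x
    F′ = map (λ _ → false) r′ ++ concatMap blockFlags π
    xs′ = r′ ++ concat π
    I = interiorCount ((m′ ∷ r′) ∷ π)

  chainWeight : MrunChain π →
    sumℤ (map weight (signings (concatMap blockFlags π) (concat π)))
      ≡ (+ 2 *ℤ x) ^ (length π ∸ 1) *ℤ (1ℤ +ℤ x) ^ (length (concat π) + 1 ∸ (length π + length π))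
  chainWeight {π} chain =
    trans (chainWeight-interior chain) (cong (λ e → (+ 2 *ℤ x) ^ (length π ∸ 1) *ℤ (1ℤ +ℤ x) ^ e) exponent)
    where
    exponent : interiorCount π ≡ length (concat π) + 1 ∸ (length π + length π)
    exponent = trans (sym (ℕₚ.m+n∸n≡m (interiorCount π) (length π + length π)))
                     (cong (_∸ (length π + length π)) (interiorCount-chain chain))

mainTheorem18 : (n : ℕ) → 1 ≤ n → (τ : List ℤ) → InRB n τ → (x : ℤ) →
    sumℤ (map (λ σ → x ^ des σ) (Orb n τ))
      ≡ ((+ 2) *ℤ x) ^ (length (mruns τ) ∸ 1)
        *ℤ (1ℤ +ℤ x) ^ (n + 1 ∸ (length (mruns τ) + length (mruns τ)))
mainTheorem18 n 1≤n .(concat π) (π , partition@(_ , nonzero , _) , mergingFree , refl) x = begin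
  sumℤ (map (weight x) (Orb n τ))
    ≡⟨ cong (λ k → sumℤ (map (weight x) (Orb k τ))) (sym length≡n) ⟩
  sumℤ (map (weight x) (Orb (length τ) τ))
    ≡⟨ sumℤ-↭ (↭.map⁺ (weight x) (Orb↭signings τ (Allₚ.concat⁺ nonzero))) ⟩
  sumℤ (map (weight x) (signings (bottomFlags τ) τ))
    ≡⟨ cong (λ B → sumℤ (map (weight x) (signings B τ))) bottoms ⟩
  sumℤ (map (weight x) (signings (concatMap blockFlags π) τ))
    ≡⟨ chainWeight x chain ⟩
  (+ 2 *ℤ x) ^ (length π ∸ 1) *ℤ (1ℤ +ℤ x) ^ (length τ + 1 ∸ (length π + length π))
    ≡⟨ cong₂ (λ k N → (+ 2 *ℤ x) ^ (k ∸ 1) *ℤ (1ℤ +ℤ x) ^ (N + 1 ∸ (k + k)))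
             (cong length (sym (mruns-concat chain))) length≡n ⟩
  (+ 2 *ℤ x) ^ (length (mruns τ) ∸ 1) *ℤ (1ℤ +ℤ x) ^ (n + 1 ∸ (length (mruns τ) + length (mruns τ))) ∎
  where
  open ≡-Reasoning
  τ = concat π
  chain = typeBPartition⇒mrunChain 1≤n partition mergingFree
  length≡n = typeBPartition-length partition
  bottoms = trans (bottomFlags-blockFlags τ) (cong (concatMap blockFlags) (mruns-concat chain))
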